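{- Let $t$ be a natural number and let $\mathit{OPT}'=\mathtt{And}(\mathtt{Timebound}(0,t,\mathtt{Give}(\mathtt{Or}(\mathtt{One}(\mathtt{USD}),\mathtt{One}(\mathtt{EUR})))),\ \mathtt{Timebound}(t+2,\mathit{INF},\mathtt{Scale}(1,\mathtt{One}(\mathtt{GBP}))))$. Let $c_{\mathit{OPT}'}$ be a contract with primitive $\mathit{OPT}'$ and issuer $I$. For all states $s,s'$ with $s$ consistent: if $O$ joins $c_{\mathit{OPT}'}$ between $s$ and $s'$ at a time before $t$, then every contract $c_{\mathit{Or}}$ generated by $c_{\mathit{OPT}'}$ whose primitive is $\mathtt{Or}(\mathtt{One}(\mathtt{USD}),\mathtt{One}(\mathtt{EUR}))$ has owner $I$ and issuer $O$.
   Context: Model of the Findel language. Addresses, identifiers and times are natural numbers; $\mathit{INF}$ is a fixed natural-number constant representing infinity. Primitives: $\mathtt{Zero}$, $\mathtt{One}(cur)$, $\mathtt{Scale}(k,P)$, $\mathtt{ScaleObs}(a,P)$, $\mathtt{Give}(P)$, $\mathtt{And}(P_1,P_2)$, $\mathtt{Or}(P_1,P_2)$, $\mathtt{If}(a,P_1,P_2)$, $\mathtt{Timebound}(t_0,t_1,P)$. $\mathrm{query}(\mathcal{G},a,\tau)$ returns $\mathtt{None}$ or $\mathtt{Some}\ v$. A contract $c$ has fields $\mathit{id}(c)$, $\mathit{dsc}(c)$, $\mathit{prim}(c)$, $\mathit{issuer}(c)$, $\mathit{owner}(c)$, proposed owner $\mathit{po}(c)$, scale $\mathit{sc}(c)$;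 a description $d$ has $\mathit{id}(d),\mathit{prim}(d),\mathit{sc}(d),\mathit{vfrom}(d),\mathit{vuntil}(d)$. $\mathrm{execute}(P,sc,I,O,B,\tau,\mathcal{G},cid,did,n,L)$ returns $\bot$ or $(B',C',n',L')$ (balance, generated contracts, fresh id, ledger): $\mathtt{Zero}\mapsto(B,[],n,L)$; $\mathtt{One}(cur)$ moves $sc$ units of $cur$ from $I$ to $O$, returns no contracts, fresh id $n+1$, and prepends the transaction (id $n$, contract $cid$, from $I$, to $O$, amount $sc$, currency $cur$, time $\tau$); $\mathtt{Scale}(k,P')$ executes $P'$ with scale $sc\cdot k$; $\mathtt{ScaleObs}(a,P')$ is $\bot$ on query failure, else executes $P'$ with scale $sc\cdot v$; $\mathtt{Give}(P')$ executes $P'$ with $I,O$ swapped; $\mathtt{And}(P_1,P_2)$ executes $P_1$ then $P_2$, threading balance, fresh id and ledger and concatenating generated contracts, $\bot$ if either fails; $\mathtt{If}(a,P_1,P_2)$ is $\bot$ on query failure, executes $P_2$ if the value is $0$, else $P_1$; $\mathtt{Timebound}(t_0,t_1,P')$ is $\bot$ if $t_1<\tau$, executes $P'$ if $t_0<\tau\le t_1$, else returns $(B,[c'],n+2,L)$ with $c'$ = (id $n+1$, description $did$, primitive $\mathtt{Timebound}(t_0,t_1,P')$, issuer $I$, owner $O$, proposed owner $O$, scale $sc$); $\mathtt{Or}(P_1,P_2)\mapsto(B,[c'],n+2,L)$ with $c'$ = (id $n+1$, description $did$, primitive $\mathtt{Or}(P_1,P_2)$, issuer $I$, owner $O$, proposed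 owner $O$, scale $sc$). A state is $s=\langle\mathcal{C},\mathcal{D},\mathcal{B},\tau,\mathcal{G},i,\mathcal{L},\mathtt{E}\rangle$ (contracts $\mathcal{C}(s)$, descriptions, balance, time $\mathit{time}(s)$, gateways, fresh id $\mathit{fresh}(s)$, ledger, events $\mathtt{E}(s)$: $\mathtt{Executed}\ j$, $\mathtt{Deleted}\ j$, $\mathtt{IssuedFor}\ a\ j$). Steps $s\curvearrowright s'$: [Issue] for $d\in\mathcal{D}$, addresses $I,O$: prepend contract (id $i$, description $\mathit{id}(d)$, primitive $\mathit{prim}(d)$, issuer $I$, owner $I$, proposed owner $O$, scale $\mathit{sc}(d)$), fresh id $i+1$, prepend $\mathtt{IssuedFor}\ O\ i$. [Join] for $c\in\mathcal{C}$, joining address $O$, with $\mathit{po}(c)\in\{O,0\}$, $\mathit{prim}(c)$ not an $\mathtt{Or}$, description $d$ of $c$ with $\mathit{vfrom}(d)\le\tau\le\mathit{vuntil}(d)$, and $\mathrm{execute}(\mathit{prim}(c),\mathit{sc}(c),\mathit{issuer}(c),O,\mathcal{B},\tau,\mathcal{G},\mathit{id}(c),\mathit{dsc}(c),i,\mathcal{L})=(\mathcal{B}',\mathcal{C}',i',\mathcal{L}')$: contracts become $(\mathcal{C}\setminus\{c\})\cup\mathcal{C}'$, balance $\mathcal{B}'$, fresh id $i'$, ledger $\mathcal{L}'$, prepend $\mathtt{Executed}\ \mathit{id}(c)$; the contracts in $\mathcal{C}'$ are the contracts generated by $c$. [Join Or] as Join with $\mathit{prim}(c)=\mathtt{Or}(P_1,P_2)$,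 executing a chosen $P\in\{P_1,P_2\}$. [Fail] under the proposed-owner and validity-time conditions, if the execution returns $\bot$: remove $c$, prepend $\mathtt{Deleted}\ \mathit{id}(c)$, generate no contracts. [Tick] time $\tau\mapsto\tau+1$. $\rightsquigarrow$ is the reflexive–transitive closure of $\curvearrowright$. A state $s$ is consistent if: (1) every $c\in\mathcal{C}(s)$ has $\mathit{fresh}(s)>\mathit{id}(c)$; (2) if $\mathtt{Executed}\ j$ or $\mathtt{Deleted}\ j$ is in $\mathtt{E}(s)$ then $\mathit{fresh}(s)>j$; (3) for $c\in\mathcal{C}(s)$ neither $\mathtt{Executed}\ \mathit{id}(c)$ nor $\mathtt{Deleted}\ \mathit{id}(c)$ is in $\mathtt{E}(s)$; (4) no $j$ has both in $\mathtt{E}(s)$. $O$ joins $c$ between $s_1$ and $s_2$ at time $\tau$ if there are states $s,s''$ with $s_1\rightsquigarrow s$, $s''\rightsquigarrow s_2$, $c\in\mathcal{C}(s)$, $\mathit{time}(s)=\tau$, and $s\curvearrowright s''$ is a Join, Join Or or Fail step on $c$ with joining address $O$ (so that $\mathtt{Executed}\ \mathit{id}(c)$ or $\mathtt{Deleted}\ \mathit{id}(c)$ is in $\mathtt{E}(s'')$). -}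

module Defs where

open import Data.Nat using (ℕ; zero; suc; _+_; _*_; _<_; _≤_; _<ᵇ_; _≡ᵇ_)
open import Data.Integer as ℤ using (ℤ; +_)
open import Data.Bool using (Bool; true; false; if_then_else_)
open import Data.Maybe using (Maybe; just; nothing)
open import Data.List using (List; []; _∷_; _++_)
open import Data.List.Membership.Propositional using (_∈_)
open import Data.Product using (_×_; _,_; Σ; ∃; ∃-syntax)
open import Data.Sum using (_⊎_)
open import Relation.Binary.PropositionalEquality using (_≡_)
open import Relation.Binary.Construct.Closure.ReflexiveTransitive using (Star)
open import Relation.Nullary using (¬_)

Address : Set
Address = ℕ

Time : Set
Time = ℕ

data Currency : Set where
  USD EUR GBP CHF JPY : Currency

_==ᶜ_ : Currency → Currency → Bool
USD ==ᶜ USD = true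
EUR ==ᶜ EUR = true
GBP ==ᶜ GBP = true
CHF ==ᶜ CHF = true
JPY ==ᶜ JPY = true
_   ==ᶜ _   = false

data Primitive : Set where
  Zero      : Primitive
  One       : Currency → Primitive
  Scale     : ℕ → Primitive → Primitive
  ScaleObs  : Address → Primitive → Primitive
  Give      : Primitive → Primitive
  And       : Primitive → Primitive → Primitive
  Or        : Primitive → Primitive → Primitive
  If        : Address → Primitive → Primitive → Primitive
  Timebound : Time → Time → Primitive → Primitive

isOr : Primitive → Bool
isOr (Or _ _) = true
isOr _        = false

Gateways : Set
Gateways = Address → Time → Maybe ℕ

query : Gateways → Address → Time → Maybe ℕ
query G a τ = G a τ

Balance : Set
Balance = Address → Currency → ℤ

transfer : Balance → Address → Address → Currency → ℕ → Balance
transfer B I O cur amt a c =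
  if c ==ᶜ cur
  then (B a c ℤ.- (if a ≡ᵇ I then + amt else + 0)) ℤ.+ (if a ≡ᵇ O then + amt else + 0)
  else B a c

record Transaction : Set where
  constructor mkTransaction
  field
    tid      : ℕ
    tcontract : ℕ
    tfrom    : Address
    tto      : Address
    tamount  : ℕ
    tcurrency : Currency
    ttime    : Time

Ledger : Set
Ledger = List Transaction

record Contract : Set where
  constructor mkContract
  field
    cid     : ℕ
    cdsc    : ℕ
    cprim   : Primitive
    cissuer : Address
    cowner  : Address
    cpo     : Address
    csc     : ℕ
open Contract public

record Description : Set where
  constructor mkDescription
  field
    did     : ℕ
    dprim   : Primitive
    dsc     : ℕ
    dvfrom  : Time
    dvuntil : Time
open Description public

Result : Set
Result = Balance × List Contract × ℕ × Ledger

execute : Primitive → ℕ → Address → Address → Balance → Time → Gateways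
        → ℕ → ℕ → ℕ → Ledger → Maybe Result
execute Zero sc I O B τ G cid d n L = just (B , [] , n , L)
execute (One cur) sc I O B τ G cid d n L =
  just (transfer B I O cur sc , [] , suc n , mkTransaction n cid I O sc cur τ ∷ L)
execute (Scale k P) sc I O B τ G cid d n L = execute P (sc * k) I O B τ G cid d n L
execute (ScaleObs a P) sc I O B τ G cid d n L with query G a τ
... | nothing = nothing
... | just v  = execute P (sc * v) I O B τ G cid d n L
execute (Give P) sc I O B τ G cid d n L = execute P sc O I B τ G cid d n L
execute (And P₁ P₂) sc I O B τ G cid d n L with execute P₁ sc I O B τ G cid d n L
... | nothing = nothing
... | just (B₁ , C₁ , n₁ , L₁) with execute P₂ sc I O B₁ τ G cid d n₁ L₁
...   | nothing = nothing
...   | just (B₂ , C₂ , n₂ , L₂) = just (B₂ , C₁ ++ C₂ , n₂ , L₂)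
execute (If a P₁ P₂) sc I O B τ G cid d n L with query G a τ
... | nothing = nothing
... | just zero    = execute P₂ sc I O B τ G cid d n L
... | just (suc _) = execute P₁ sc I O B τ G cid d n L
execute (Timebound t₀ t₁ P) sc I O B τ G cid d n L =
  if t₁ <ᵇ τ then nothing
  else if t₀ <ᵇ τ then execute P sc I O B τ G cid d n L
  else just (B , mkContract (suc n) d (Timebound t₀ t₁ P) I O O sc ∷ [] , suc (suc n) , L)
execute (Or P₁ P₂) sc I O B τ G cid d n L =
  just (B , mkContract (suc n) d (Or P₁ P₂) I O O sc ∷ [] , suc (suc n) , L)

data Event : Set where
  Executed  : ℕ → Event
  Deleted   : ℕ → Event
  IssuedFor : Address → ℕ → Event

record State : Set where
  constructor mkState
  field
    contracts    : List Contract
    descriptions : List Description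
    balance      : Balance
    time         : Time
    gateways     : Gateways
    fresh        : ℕ
    ledger       : Ledger
    events       : List Event
open State public

ValidDesc : State → Contract → Description → Set
ValidDesc s c d = d ∈ descriptions s × did d ≡ cdsc c × dvfrom d ≤ time s × time s ≤ dvuntil d

POk : Contract → Address → Set
POk c O = cpo c ≡ O ⊎ cpo c ≡ 0

exec : State → Contract → Address → Primitive → Maybe Result
exec s c O P = execute P (csc c) (cissuer c) O (balance s) (time s) (gateways s)
                       (cid c) (cdsc c) (fresh s) (ledger s)

afterJoin : State → Contract → List Contract → List Contract → Result → State
afterJoin s c xs ys (B′ , C′ , i′ , L′) = record s
  { contracts = xs ++ ys ++ C′ ; balance = B′ ; fresh = i′ ; ledger = L′
  ; events = Executed (cid c) ∷ events s }

-- JoinStep s c O C′ s″ : s ↷ s″ is a Join, Join Or or Fail step on c with joining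
-- address O, and C′ is the list of contracts generated by c in this step.
-- (C ∖ {c}) is represented by splitting the contract list as xs ++ c ∷ ys.
data JoinStep (s : State) (c : Contract) (O : Address) : List Contract → State → Set where
  join   : ∀ xs ys d B′ C′ i′ L′ →
           contracts s ≡ xs ++ c ∷ ys → POk c O → isOr (cprim c) ≡ false → ValidDesc s c d →
           exec s c O (cprim c) ≡ just (B′ , C′ , i′ , L′) →
           JoinStep s c O C′ (afterJoin s c xs ys (B′ , C′ , i′ , L′))
  joinOr : ∀ xs ys d P₁ P₂ P B′ C′ i′ L′ →
           contracts s ≡ xs ++ c ∷ ys → POk c O → cprim c ≡ Or P₁ P₂ → ValidDesc s c d →
           (P ≡ P₁ ⊎ P ≡ P₂) →
           exec s c O P ≡ just (B′ , C′ , i′ , L′) →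
           JoinStep s c O C′ (afterJoin s c xs ys (B′ , C′ , i′ , L′))
  fail   : ∀ xs ys d P →
           contracts s ≡ xs ++ c ∷ ys → POk c O → ValidDesc s c d →
           ((isOr (cprim c) ≡ false × P ≡ cprim c)
             ⊎ Σ Primitive (λ P₁ → Σ Primitive (λ P₂ → cprim c ≡ Or P₁ P₂ × (P ≡ P₁ ⊎ P ≡ P₂)))) →
           exec s c O P ≡ nothing →
           JoinStep s c O [] (record s { contracts = xs ++ ys
                                       ; events = Deleted (cid c) ∷ events s })

issueContract : State → Description → Address → Address → Contract
issueContract s d I O = mkContract (fresh s) (did d) (dprim d) I I O (dsc d)

data _↷_ : State → State → Set where
  issue : ∀ s d I O → d ∈ descriptions s →
          s ↷ record s { contracts = issueContract s d I O ∷ contracts s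
                       ; fresh = suc (fresh s)
                       ; events = IssuedFor O (fresh s) ∷ events s }
  joinStep : ∀ s c O C′ s″ → JoinStep s c O C′ s″ → s ↷ s″
  tick : ∀ s → s ↷ record s { time = suc (time s) }

_⇝_ : State → State → Set
_⇝_ = Star _↷_

Consistent : State → Set
Consistent s =
  (∀ c → c ∈ contracts s → cid c < fresh s) ×
  (∀ j → (Executed j ∈ events s ⊎ Deleted j ∈ events s) → j < fresh s) ×
  (∀ c → c ∈ contracts s → ¬ (Executed (cid c) ∈ events s) × ¬ (Deleted (cid c) ∈ events s)) ×
  (∀ j → ¬ (Executed j ∈ events s × Deleted j ∈ events s))

JoinsBetween : Address → Contract → State → State → Time → List Contract → Set
JoinsBetween O c s₁ s₂ τ C′ =
  Σ State λ s → Σ State λ s″ →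
    s₁ ⇝ s × s″ ⇝ s₂ × c ∈ contracts s × time s ≡ τ × JoinStep s c O C′ s″

OPT′ : ℕ → Time → Primitive
OPT′ INF t = And (Timebound 0 t (Give (Or (One USD) (One EUR))))
                 (Timebound (t + 2) INF (Scale 1 (One GBP)))

module Submission where

-- A join step on c either fails (and generates no contracts) or,
-- since prim(c) = OPT′ is an And and not an Or, is a plain Join whose generated
-- contracts are exactly those produced by one successful execution of OPT′ from
-- issuer I to owner O.  We name this notion `Generates` and invert it one
-- primitive at a time:
--   * And P₁ P₂ generates C₁ ++ C₂, where Pᵢ generates Cᵢ;
--   * Timebound t₀ t₁ P either behaves as P or defers itself as one Timebound
--     contract (an expired Timebound fails, so it generates nothing);
--   * Or P₁ P₂ generates one Or contract with issuer I and owner O;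
--   * One cur generates nothing.
-- The left leg Timebound 0 t (Give (Or (One USD) (One EUR))) therefore yields at
-- most one Or contract, created with the roles swapped by Give: issuer O and
-- owner I.  The right leg yields no Or contract at all.

open import Defs
open import Data.Nat using (ℕ; _<_; _<ᵇ_; _*_; suc)
open import Data.List using (List; []; _∷_; _++_)
open import Data.List.Membership.Propositional using (_∈_)
open import Data.List.Membership.Propositional.Properties using (∈-++⁻)
open import Data.List.Relation.Unary.Any using (here)
open import Data.Product using (_×_; _,_; ∃; ∃₂)
open import Data.Sum using (_⊎_; inj₁; inj₂)
open import Data.Bool using (true; false)
open import Data.Maybe using (just)
open import Relation.Binary.PropositionalEquality using (_≡_; refl; trans; sym; cong)

OrOwnedBy : Address → Address → List Contract → Set
OrOwnedBy I O C = ∀ {x} → x ∈ C → cprim x ≡ Or (One USD) (One EUR) → cowner x ≡ I × cissuer x ≡ O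

orOwnedBy-[] : ∀ {I O} → OrOwnedBy I O []
orOwnedBy-[] ()

orOwnedBy-++ : ∀ {I O} C₁ {C₂} → OrOwnedBy I O C₁ → OrOwnedBy I O C₂ → OrOwnedBy I O (C₁ ++ C₂)
orOwnedBy-++ C₁ own₁ own₂ x∈ with ∈-++⁻ C₁ x∈
... | inj₁ x∈₁ = own₁ x∈₁
... | inj₂ x∈₂ = own₂ x∈₂

orOwnedBy-deferred : ∀ {I O m d t₀ t₁ P I′ O′ sc} →
  OrOwnedBy I O (mkContract m d (Timebound t₀ t₁ P) I′ O′ O′ sc ∷ [])
orOwnedBy-deferred (here refl) ()

module _ (τ : Time) (G : Gateways) (ci d : ℕ) where

  data Generates (P : Primitive) (sc : ℕ) (I O : Address) (C : List Contract) : Set where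
    generates : ∀ B n L B′ n′ L′ →
      execute P sc I O B τ G ci d n L ≡ just (B′ , C , n′ , L′) → Generates P sc I O C

  generates-And : ∀ {P₁ P₂ sc I O C} → Generates (And P₁ P₂) sc I O C →
    ∃₂ λ C₁ C₂ → C ≡ C₁ ++ C₂ × Generates P₁ sc I O C₁ × Generates P₂ sc I O C₂
  generates-And {P₁} {P₂} {sc} {I} {O} (generates B n L B′ n′ L′ eq)
    with execute P₁ sc I O B τ G ci d n L in e₁
  ... | just (B₁ , C₁ , n₁ , L₁) with execute P₂ sc I O B₁ τ G ci d n₁ L₁ in e₂
  ...   | just (B₂ , C₂ , n₂ , L₂) with eq
  ...     | refl = C₁ , C₂ , refl , generates B n L B₁ n₁ L₁ e₁ , generates B₁ n₁ L₁ B₂ n₂ L₂ e₂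

  generates-Timebound : ∀ {t₀ t₁ P sc I O C} → Generates (Timebound t₀ t₁ P) sc I O C →
    Generates P sc I O C ⊎ ∃ λ m → C ≡ mkContract m d (Timebound t₀ t₁ P) I O O sc ∷ []
  generates-Timebound {t₀} {t₁} (generates B n L B′ n′ L′ eq) with t₁ <ᵇ τ | t₀ <ᵇ τ | eq
  ... | false | true  | body = inj₁ (generates B n L B′ n′ L′ body)
  ... | false | false | refl = inj₂ (suc n , refl)

  generates-Or : ∀ {P₁ P₂ sc I O C} → Generates (Or P₁ P₂) sc I O C →
    ∃ λ m → C ≡ mkContract m d (Or P₁ P₂) I O O sc ∷ []
  generates-Or (generates B n L B′ n′ L′ refl) = suc n , refl

  generates-Give : ∀ {P sc I O C} → Generates (Give P) sc I O C → Generates P sc O I C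
  generates-Give (generates B n L B′ n′ L′ eq) = generates B n L B′ n′ L′ eq

  generates-Scale : ∀ {k P sc I O C} → Generates (Scale k P) sc I O C → Generates P (sc * k) I O C
  generates-Scale (generates B n L B′ n′ L′ eq) = generates B n L B′ n′ L′ eq

  generates-One : ∀ {cur sc I O C} → Generates (One cur) sc I O C → C ≡ []
  generates-One (generates B n L B′ n′ L′ refl) = refl

joinStep-generates : ∀ {s c O C′ s″} → JoinStep s c O C′ s″ → isOr (cprim c) ≡ false →
  C′ ≡ [] ⊎ Generates (time s) (gateways s) (cid c) (cdsc c) (cprim c) (csc c) (cissuer c) O C′
joinStep-generates {s} (join _ _ _ B′ _ i′ L′ _ _ _ _ ex) _ =
  inj₂ (generates (balance s) (fresh s) (ledger s) B′ i′ L′ ex)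
joinStep-generates (joinOr _ _ _ _ _ _ _ _ _ _ _ _ isOr≡Or _ _ _) notOr
  with trans (sym notOr) (cong isOr isOr≡Or)
... | ()
joinStep-generates (fail _ _ _ _ _ _ _ _ _) _ = inj₁ refl

-- The option leg yields, besides possibly a deferred copy of itself, only the
-- Or contract created under Give, whose issuer and owner are swapped.
optionLeg-owned : ∀ {τ G ci d t sc I O C} →
  Generates τ G ci d (Timebound 0 t (Give (Or (One USD) (One EUR)))) sc I O C → OrOwnedBy I O C
optionLeg-owned gen with generates-Timebound _ _ _ _ gen
... | inj₂ (_ , refl) = orOwnedBy-deferred
... | inj₁ body with generates-Or _ _ _ _ (generates-Give _ _ _ _ body)
...   | _ , refl = λ { (here refl) _ → refl , refl }

paymentLeg-owned : ∀ {τ G ci d t₀ t₁ k cur sc I O C} →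
  Generates τ G ci d (Timebound t₀ t₁ (Scale k (One cur))) sc I O C → OrOwnedBy I O C
paymentLeg-owned gen with generates-Timebound _ _ _ _ gen
... | inj₂ (_ , refl) = orOwnedBy-deferred
... | inj₁ body with generates-One _ _ _ _ (generates-Scale _ _ _ _ body)
...   | refl = orOwnedBy-[]

opt′-owned : ∀ {τ G ci d INF t sc I O C} → Generates τ G ci d (OPT′ INF t) sc I O C → OrOwnedBy I O C
opt′-owned gen with generates-And _ _ _ _ gen
... | C₁ , _ , refl , option , payment =
  orOwnedBy-++ C₁ (optionLeg-owned option) (paymentLeg-owned payment)

proposition12 : (INF t : ℕ) (c : Contract) (I O : Address) →
    cprim c ≡ OPT′ INF t → cissuer c ≡ I →
    (s s′ : State) → Consistent s →
    (τ : Time) (C′ : List Contract) → JoinsBetween O c s s′ τ C′ → τ < t →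
    (cOr : Contract) → cOr ∈ C′ → cprim cOr ≡ Or (One USD) (One EUR) →
    cowner cOr ≡ I × cissuer cOr ≡ O
proposition12 _ _ c I O prim≡OPT′ refl _ _ _ _ C′ (s₀ , _ , _ , _ , _ , _ , step) _ _ cOr∈C′ =
  generated-owned (joinStep-generates step (cong isOr prim≡OPT′)) cOr∈C′
  where
  generated-owned : C′ ≡ [] ⊎ Generates (time s₀) (gateways s₀) (cid c) (cdsc c) (cprim c) (csc c) I O C′ →
    OrOwnedBy I O C′
  generated-owned (inj₁ refl) = orOwnedBy-[]
  generated-owned (inj₂ gen) rewrite prim≡OPT′ = opt′-owned gen
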